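{- Let $p$ be a prime, let $A$ be a matrix over $GF(p)$ whose columns are labelled by a finite set $E$, let $M=M[A]$ be connected, let $a,b\in E$ be distinct, $\alpha\in GF(p)\setminus\{0\}$, and let $M_{a,b}$ be the splitting matroid. If for every proper subset $S$ of $E$ with $|S|\ge1$, either $S$ or $T=E\setminus S$ contains an $np$-circuit of $M$, then $M_{a,b}$ is connected.
   Context: A matroid with ground set $E$ and rank function $r$ is connected if it has no $1$-separation, i.e. no partition $(S,T)$ of $E$ with $|S|,|T|\ge1$ and $r(S)+r(T)-r(E)<1$. The splitting matroid $M_{a,b}$ is $M[A_{a,b}]$, where $A_{a,b}$ is $A$ with an appended row having entries $\alpha$ in columns $a,b$ and $0$ elsewhere. For a circuit $C$ of $M$, its columns satisfy $\sum_{u\in C}c_u u=0$ over $GF(p)$ with all $c_u\ne0$ (unique up to nonzero scalar). $C$ is an $np$-circuit if $|C\cap\{a,b\}|=1$, or $a,b\in C$ and $c_a+c_b\ne0$. -}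

module Defs where

open import Data.Nat using (ℕ; zero; suc; _+_; _*_; _≤_)
open import Data.Nat.Divisibility using (_∣_)
open import Data.Bool using (Bool; true; false; if_then_else_)
open import Data.Fin using (Fin; _≟_)
import Data.Fin as F
open import Data.Vec using (lookup; tabulate)
open import Data.Vec.Functional using (foldr)
open import Data.Fin.Subset using (Subset; _∈_; _∉_; _⊆_; _⊂_; ∁; ⊤; Nonempty; ∣_∣)
open import Data.Product using (Σ; ∃; _×_; _,_)
open import Data.Sum using (_⊎_)
open import Relation.Nullary using (¬_; does)
open import Relation.Binary.PropositionalEquality using (_≡_)

-- Elements of GF(p) are represented by natural numbers, read modulo p:
-- x = 0 in GF(p)  iff  p ∣ x.
-- A matrix over GF(p) with m rows and columns labelled by E = Fin n.
Matrix : ℕ → ℕ → Set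
Matrix m n = Fin m → Fin n → ℕ

Σ[_] : ∀ {n} → (Fin n → ℕ) → ℕ
Σ[ f ] = foldr _+_ 0 f

lincomb : ∀ {m n} → Matrix m n → Subset n → (Fin n → ℕ) → Fin m → ℕ
lincomb A S c i = Σ[ (λ u → if lookup S u then c u * A i u else 0) ]

IsZeroComb : ∀ {m n} (p : ℕ) → Matrix m n → Subset n → (Fin n → ℕ) → Set
IsZeroComb p A S c = ∀ i → p ∣ lincomb A S c i

Independent : ∀ {m n} (p : ℕ) → Matrix m n → Subset n → Set
Independent p A S = ∀ c → IsZeroComb p A S c → ∀ u → u ∈ S → p ∣ c u

Dependent : ∀ {m n} (p : ℕ) → Matrix m n → Subset n → Set
Dependent p A S = ¬ Independent p A S

IsRank : ∀ {m n} (p : ℕ) → Matrix m n → Subset n → ℕ → Set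
IsRank p A S k =
  (∃ λ I → I ⊆ S × Independent p A I × ∣ I ∣ ≡ k) ×
  (∀ I → I ⊆ S → Independent p A I → ∣ I ∣ ≤ k)

-- a 1-separation of M[A]: a partition (S , E∖S) with both parts nonempty
-- and r(S) + r(T) - r(E) < 1, i.e. r(S) + r(T) ≤ r(E)
OneSeparation : ∀ {m n} (p : ℕ) → Matrix m n → Subset n → Set
OneSeparation p A S =
  Nonempty S × Nonempty (∁ S) ×
  Σ ℕ λ rS → Σ ℕ λ rT → Σ ℕ λ rE →
    IsRank p A S rS × IsRank p A (∁ S) rT × IsRank p A ⊤ rE × rS + rT ≤ rE

Connected : ∀ {m n} (p : ℕ) → Matrix m n → Set
Connected p A = ∀ S → ¬ OneSeparation p A S

IsCircuit : ∀ {m n} (p : ℕ) → Matrix m n → Subset n → Set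
IsCircuit p A C = Dependent p A C × (∀ D → D ⊂ C → Independent p A D)

IsCircuitCoeffs : ∀ {m n} (p : ℕ) → Matrix m n → Subset n → (Fin n → ℕ) → Set
IsCircuitCoeffs p A C c = IsZeroComb p A C c × (∀ u → u ∈ C → ¬ (p ∣ c u))

IsNpCircuit : ∀ {m n} (p : ℕ) → Matrix m n → Fin n → Fin n → Subset n → Set
IsNpCircuit p A a b C =
  IsCircuit p A C ×
  ( (a ∈ C × b ∉ C)
  ⊎ (a ∉ C × b ∈ C)
  ⊎ (a ∈ C × b ∈ C × ∃ λ c → IsCircuitCoeffs p A C c × ¬ (p ∣ c a + c b)))

ContainsNpCircuit : ∀ {m n} (p : ℕ) → Matrix m n → Fin n → Fin n → Subset n → Set
ContainsNpCircuit p A a b S = ∃ λ C → C ⊆ S × IsNpCircuit p A a b C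

-- A_{a,b}: A with an appended row having α in columns a, b and 0 elsewhere
-- (the new row is placed as row 0; the row order does not affect the matroid)
splitMatrix : ∀ {m n} → Matrix m n → Fin n → Fin n → ℕ → Matrix (suc m) n
splitMatrix A a b α F.zero u =
  if does (u ≟ a) then α else (if does (u ≟ b) then α else 0)
splitMatrix A a b α (F.suc i) u = A i u

{-# OPTIONS --safe #-}
-- Write A′ for A with the new row and r, r′ for the rank functions of M = M[A] and M_{a,b} = M[A′].
-- Adding a row never lowers the rank of a set and raises it by at most one. If X contains an
-- np-circuit C, the new row does not vanish on the dependency of C, and then r′(X) = r(X) + 1:
-- if a basis I of X in M stayed maximal in M_{a,b}, every column of X would be a combination of
-- those of I, forcing the new row to vanish on every dependency of X. So a 1-separation (S , T)
-- of M_{a,b}, with an np-circuit in S say, gives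
--   r(S) + r(T) + 1 ≤ r′(S) + r′(T) ≤ r′(E) ≤ r(E) + 1,
-- a 1-separation of M. Since independence quantifies over all coefficient vectors, ranks exist
-- only classically; connectedness is a negation, so the argument runs in the double-negation monad.

module Submission where

open import Defs
open import Data.Nat using (ℕ)
open import Data.Nat.Divisibility using (_∣_)
open import Data.Nat.Primality using (Prime)
open import Data.Fin using (Fin)
open import Data.Fin.Subset using (Subset; _⊂_; ⊤; Nonempty; ∁)
open import Relation.Nullary using (¬_)
open import Relation.Binary.PropositionalEquality using (_≡_)
open import Data.Sum using (_⊎_)

open import Data.Bool using (true; false; if_then_else_)
open import Data.Fin using (zero; suc; _≟_)
open import Data.Fin.Subset using (_∈_; _∉_; _⊆_; _-_; _∪_; ⁅_⁆; ⊥; ∣_∣; inside; outside)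
open import Data.Fin.Subset.Properties
  using (_∈?_; ∈⊤; ∉⊥; ⊥⊆; ∣⊥∣≡0; ∣p∣≤n; x∈∁p⇒x∉p; p─q⊆p; p─⊥≡p; x∈p∧x≢y⇒x∈p-y;
         x∈p⇒p-x⊂p; p⊆p∪q; q⊆p∪q; x∈⁅x⁆; x∈p∪q⁻; x∈⁅y⁆⇒x≡y; p⊂q⇒∣p∣<∣q∣)
open import Data.List using (List; []; _∷_; allFin)
open import Data.List.Relation.Unary.All as All using (All; []; _∷_)
open import Data.List.Membership.Propositional.Properties using (∈-allFin)
open import Data.Nat using (zero; suc; pred; _+_; _*_; _≤_; _<_; _≤?_; _<?_; s≤s; s≤s⁻¹; NonZero)
open import Data.Nat.Divisibility using (_∣?_; _∣0; m∣m*n; ∣m∣n⇒∣m+n; ∣m+n∣m⇒∣n; ∣m⇒∣m*n; ∣n⇒∣m*n)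
open import Data.Nat.Primality using (euclidsLemma; prime⇒nonZero)
open import Data.Nat.Properties
  using (+-*-semiring; +-identityʳ; +-comm; *-zeroʳ; *-comm; *-assoc; *-distribʳ-+; suc-pred;
         ≤-reflexive; ≤-trans; n≤1+n; m≤n⇒m<n∨m≡n; ≮⇒≥; <⇒≱; +-mono-<-≤; +-mono-≤-<; module ≤-Reasoning)
open import Algebra.Properties.Semiring.Sum +-*-semiring
  using (sum; sum-cong-≗; ∑-distrib-+; *-distribˡ-sum; sum-replicate-zero)
open import Data.Product using (∃; _×_; _,_; proj₁)
open import Data.Sum using (inj₁; inj₂; [_,_]′)
open import Data.Vec using (lookup; _∷_; there)
open import Data.Vec.Properties using ([]=⇒lookup; lookup⇒[]=)
open import Data.Vec.Functional using (tail)
open import Effect.Monad using (RawMonad)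
open import Function using (id)
open import Level using (0ℓ)
open import Relation.Nullary using (yes; no; does; contradiction)
open import Relation.Nullary.Negation using (¬¬-Monad)
open import Relation.Nullary.Decidable using (¬¬-excluded-middle; decidable-stable)
open import Relation.Binary.PropositionalEquality
  using (_≢_; refl; sym; trans; cong; cong₂; subst; module ≡-Reasoning)

open RawMonad (¬¬-Monad {0ℓ})

∣-sum : ∀ {n d} (f : Fin n → ℕ) → (∀ u → d ∣ f u) → d ∣ sum f
∣-sum {zero}  {d} f d∣f = d ∣0
∣-sum {suc n}     f d∣f = ∣m∣n⇒∣m+n (d∣f zero) (∣-sum (λ u → f (suc u)) (λ u → d∣f (suc u)))

sum-indicator : ∀ {n} (x : Fin n) (v : ℕ) → sum (λ u → if does (u ≟ x) then v else 0) ≡ v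
sum-indicator {suc n} zero    v = trans (cong (v +_) (sum-replicate-zero n)) (+-identityʳ v)
sum-indicator {suc n} (suc x) v = sum-indicator x v

∉⇒lookup≡false : ∀ {n} {T : Subset n} {u} → u ∉ T → lookup T u ≡ false
∉⇒lookup≡false {T = T} {u} u∉T with lookup T u in eq
... | true  = contradiction (lookup⇒[]= u T eq) u∉T
... | false = refl

lookup≡false⇒∉ : ∀ {n} {T : Subset n} {u} → lookup T u ≡ false → u ∉ T
lookup≡false⇒∉ eq u∈T with trans (sym ([]=⇒lookup u∈T)) eq
... | ()

x∉p-x : ∀ {n} (p : Subset n) x → x ∉ p - x
x∉p-x (_ ∷ p) zero    ()
x∉p-x (_ ∷ p) (suc x) (there x∈p-x) = x∉p-x p x x∈p-x

∣p∣≤1+∣p-x∣ : ∀ {n} (p : Subset n) x → ∣ p ∣ ≤ suc ∣ p - x ∣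
∣p∣≤1+∣p-x∣ (inside  ∷ p) zero    = s≤s (≤-reflexive (cong ∣_∣ (sym (p─⊥≡p p))))
∣p∣≤1+∣p-x∣ (outside ∷ p) zero    = ≤-trans (≤-reflexive (cong ∣_∣ (sym (p─⊥≡p p)))) (n≤1+n _)
∣p∣≤1+∣p-x∣ (inside  ∷ p) (suc x) = s≤s (∣p∣≤1+∣p-x∣ p x)
∣p∣≤1+∣p-x∣ (outside ∷ p) (suc x) = ∣p∣≤1+∣p-x∣ p x

∈p∪⁅x⁆-elim : ∀ {n} {p : Subset n} {x} (P : Fin n → Set) →
              (∀ {y} → y ∈ p → P y) → P x → ∀ {y} → y ∈ p ∪ ⁅ x ⁆ → P y
∈p∪⁅x⁆-elim {p = p} {x} P on-p at-x {y} y∈ with x∈p∪q⁻ p ⁅ x ⁆ y∈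
... | inj₁ y∈p   = on-p y∈p
... | inj₂ y∈⁅x⁆ = subst P (sym (x∈⁅y⁆⇒x≡y x y∈⁅x⁆)) at-x

-- pred p represents −1 in GF(p).
p∣x*y+pred[p]*y*x : ∀ p .{{_ : NonZero p}} x y → p ∣ x * y + pred p * y * x
p∣x*y+pred[p]*y*x p x y = subst (p ∣_) (sym (begin
  x * y + pred p * y * x     ≡⟨ cong (x * y +_) (trans (*-assoc (pred p) y x) (cong (pred p *_) (*-comm y x))) ⟩
  suc (pred p) * (x * y)     ≡⟨ cong (_* (x * y)) (suc-pred p) ⟩
  p * (x * y)                ∎)) (m∣m*n (x * y))
  where open ≡-Reasoning

restrict : ∀ {n} → Subset n → (Fin n → ℕ) → Fin n → ℕ
restrict T f u = if lookup T u then f u else 0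

restrict-∈ : ∀ {n} {T : Subset n} {u} (f : Fin n → ℕ) → u ∈ T → restrict T f u ≡ f u
restrict-∈ f u∈T rewrite []=⇒lookup u∈T = refl

restrict-∉ : ∀ {n} {T : Subset n} {u} (f : Fin n → ℕ) → u ∉ T → restrict T f u ≡ 0
restrict-∉ f u∉T rewrite ∉⇒lookup≡false u∉T = refl

module _ {m n : ℕ} (B : Matrix m n) where

  lincomb-linear : ∀ T k l (f g : Fin n → ℕ) i →
    lincomb B T (λ u → k * f u + l * g u) i ≡ k * lincomb B T f i + l * lincomb B T g i
  lincomb-linear T k l f g i = begin
    sum (λ u → term (λ u → k * f u + l * g u) u)   ≡⟨ sum-cong-≗ pointwise ⟩
    sum (λ u → k * term f u + l * term g u)
      ≡⟨ ∑-distrib-+ (λ u → k * term f u) (λ u → l * term g u) ⟩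
    sum (λ u → k * term f u) + sum (λ u → l * term g u)
      ≡⟨ sym (cong₂ _+_ (*-distribˡ-sum k (term f)) (*-distribˡ-sum l (term g))) ⟩
    k * lincomb B T f i + l * lincomb B T g i     ∎
    where
    open ≡-Reasoning
    term : (Fin n → ℕ) → Fin n → ℕ
    term h u = if lookup T u then h u * B i u else 0
    pointwise : ∀ u → term (λ u → k * f u + l * g u) u ≡ k * term f u + l * term g u
    pointwise u with lookup T u
    ... | true  = trans (*-distribʳ-+ (B i u) (k * f u) (l * g u))
                        (cong₂ _+_ (*-assoc k (f u) (B i u)) (*-assoc l (g u) (B i u)))
    ... | false = sym (cong₂ _+_ (*-zeroʳ k) (*-zeroʳ l))

  lincomb-restrict : ∀ {T S} → T ⊆ S → ∀ f i → lincomb B S (restrict T f) i ≡ lincomb B T f i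
  lincomb-restrict {T} {S} T⊆S f i = sum-cong-≗ pointwise
    where
    pointwise : ∀ u → (if lookup S u then restrict T f u * B i u else 0)
                    ≡ (if lookup T u then f u * B i u else 0)
    pointwise u with lookup S u in eS | lookup T u in eT
    ... | true  | true  = refl
    ... | true  | false = refl
    ... | false | false = refl
    ... | false | true  = contradiction (T⊆S (lookup⇒[]= u T eT)) (lookup≡false⇒∉ eS)

  lincomb-split : ∀ {T S} → T ⊆ S → ∀ f i →
    lincomb B S f i ≡ lincomb B T f i + lincomb B S (λ u → if lookup T u then 0 else f u) i
  lincomb-split {T} {S} T⊆S f i = trans (sum-cong-≗ pointwise)
    (∑-distrib-+ (λ u → if lookup T u then f u * B i u else 0)
                 (λ u → if lookup S u then (if lookup T u then 0 else f u) * B i u else 0))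
    where
    pointwise : ∀ u → (if lookup S u then f u * B i u else 0)
                    ≡ (if lookup T u then f u * B i u else 0)
                      + (if lookup S u then (if lookup T u then 0 else f u) * B i u else 0)
    pointwise u with lookup S u in eS | lookup T u in eT
    ... | true  | true  = sym (+-identityʳ _)
    ... | true  | false = refl
    ... | false | false = refl
    ... | false | true  = contradiction (T⊆S (lookup⇒[]= u T eT)) (lookup≡false⇒∉ eS)

  ∣-lincomb : ∀ {p} T f i → (∀ u → u ∈ T → p ∣ f u) → p ∣ lincomb B T f i
  ∣-lincomb {p} T f i p∣f = ∣-sum _ p∣term
    where
    p∣term : ∀ u → p ∣ (if lookup T u then f u * B i u else 0)
    p∣term u with lookup T u in eT
    ... | true  = ∣m⇒∣m*n (B i u) (p∣f u (lookup⇒[]= u T eT))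
    ... | false = p ∣0

  module _ {p : ℕ} where

    isZeroComb-linear : ∀ {T f g} → IsZeroComb p B T f → IsZeroComb p B T g →
                        ∀ k l → IsZeroComb p B T (λ u → k * f u + l * g u)
    isZeroComb-linear {T} {f} {g} zf zg k l i =
      subst (p ∣_) (sym (lincomb-linear T k l f g i))
            (∣m∣n⇒∣m+n (∣n⇒∣m*n k (zf i)) (∣n⇒∣m*n l (zg i)))

    isZeroComb-restrict : ∀ {T S f} → T ⊆ S → IsZeroComb p B T f → IsZeroComb p B S (restrict T f)
    isZeroComb-restrict {f = f} T⊆S zf i = subst (p ∣_) (sym (lincomb-restrict T⊆S f i)) (zf i)

    isZeroComb-shrink : ∀ {T S f} → T ⊆ S → (∀ u → u ∈ S → u ∉ T → p ∣ f u) →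
                        IsZeroComb p B S f → IsZeroComb p B T f
    isZeroComb-shrink {T} {S} {f} T⊆S p∣f zf i =
      ∣m+n∣m⇒∣n (subst (p ∣_) (trans (lincomb-split T⊆S f i) (+-comm (lincomb B T f i) _)) (zf i))
                (∣-lincomb S _ i p∣outside)
      where
      p∣outside : ∀ u → u ∈ S → p ∣ (if lookup T u then 0 else f u)
      p∣outside u u∈S with lookup T u in eT
      ... | true  = p ∣0
      ... | false = p∣f u u∈S (lookup≡false⇒∉ eT)

¬¬-maximum : ∀ N (Q : ℕ → Set) → Q 0 → ¬ ¬ ∃ λ k → Q k × (∀ j → j ≤ N → Q j → j ≤ k)
¬¬-maximum zero    Q q0 = pure (0 , q0 , λ j j≤0 _ → j≤0)
¬¬-maximum (suc N) Q q0 = do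
  (k , qk , max) ← ¬¬-maximum N Q q0
  no ¬qN+1 ← ¬¬-excluded-middle
    where yes qN+1 → pure (suc N , qN+1 , λ j j≤N+1 _ → j≤N+1)
  pure (k , qk , λ j j≤N+1 qj →
    [ (λ j<N+1 → max j (s≤s⁻¹ j<N+1) qj) , (λ j≡N+1 → contradiction (subst Q j≡N+1 qj) ¬qN+1) ]′
      (m≤n⇒m<n∨m≡n j≤N+1))

module _ {m n : ℕ} (p : ℕ) (B : Matrix m n) where

  ¬¬-rank : ∀ X → ¬ ¬ ∃ (IsRank p B X)
  ¬¬-rank X = do
    (k , largest , max) ← ¬¬-maximum n IndependentOfSize empty
    pure (k , largest , λ J J⊆X indJ → max ∣ J ∣ (∣p∣≤n J) (J , (λ {v} → J⊆X {v}) , indJ , refl))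
    where
    IndependentOfSize : ℕ → Set
    IndependentOfSize k = ∃ λ I → I ⊆ X × Independent p B I × ∣ I ∣ ≡ k
    empty : IndependentOfSize 0
    empty = ⊥ , ⊥⊆ , (λ _ _ u u∈⊥ → contradiction u∈⊥ ∉⊥) , ∣⊥∣≡0 n

  ¬¬-nontrivialZeroComb : ∀ {T} → Dependent p B T →
    ¬ ¬ ∃ λ c → IsZeroComb p B T c × ∃ λ u → u ∈ T × ¬ p ∣ c u
  ¬¬-nontrivialZeroComb dep ¬nontrivial =
    dep λ c zc u u∈T → decidable-stable (p ∣? c u) λ ¬p∣cu → ¬nontrivial (c , zc , u , u∈T , ¬p∣cu)

  circuit⇒¬¬nonzeroCoefficient : ∀ {C x} → IsCircuit p B C → x ∈ C →
    ¬ ¬ ∃ λ c → IsZeroComb p B C c × ¬ p ∣ c x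
  circuit⇒¬¬nonzeroCoefficient {C} {x} (dep , minimal) x∈C = do
    (c , zc , u , u∈C , ¬p∣cu) ← ¬¬-nontrivialZeroComb dep
    no ¬p∣cx ← pure (p ∣? c x)
      where yes p∣cx → contradiction (vanishes c zc p∣cx u u∈C) ¬p∣cu
    pure (c , zc , ¬p∣cx)
    where
    C-x⊂C : C - x ⊂ C
    C-x⊂C = x∈p⇒p-x⊂p x∈C
    vanishes : ∀ c → IsZeroComb p B C c → p ∣ c x → ∀ u → u ∈ C → p ∣ c u
    vanishes c zc p∣cx u u∈C with u ≟ x
    ... | yes refl = p∣cx
    ... | no u≢x   = minimal (C - x) C-x⊂C c zc′ u (x∈p∧x≢y⇒x∈p-y u∈C u≢x)
      where
      off-C-x : ∀ v → v ∈ C → v ∉ C - x → p ∣ c v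
      off-C-x v v∈C v∉C-x with v ≟ x
      ... | yes refl = p∣cx
      ... | no v≢x   = contradiction (x∈p∧x≢y⇒x∈p-y v∈C v≢x) v∉C-x
      zc′ : IsZeroComb p B (C - x) c
      zc′ = isZeroComb-shrink B (proj₁ C-x⊂C) off-C-x zc

module OneMoreRow {m n p : ℕ} (p-prime : Prime p) (B : Matrix (suc m) n) where

  private instance
    p≢0 : NonZero p
    p≢0 = prime⇒nonZero p-prime

  row₀ : Subset n → (Fin n → ℕ) → ℕ
  row₀ T f = lincomb B T f zero

  independent-tail⇒independent : ∀ {T} → Independent p (tail B) T → Independent p B T
  independent-tail⇒independent ind c zc = ind c (λ i → zc (suc i))

  zeroComb-tail⇒zeroComb : ∀ {T c} → IsZeroComb p (tail B) T c → p ∣ row₀ T c → IsZeroComb p B T c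
  zeroComb-tail⇒zeroComb zc p∣row₀ zero    = p∣row₀
  zeroComb-tail⇒zeroComb zc p∣row₀ (suc i) = zc i

  rank-tail≤rank : ∀ {Y k k′} → IsRank p (tail B) Y k → IsRank p B Y k′ → k ≤ k′
  rank-tail≤rank ((I , I⊆Y , indI , refl) , _) (_ , maximal) =
    maximal I I⊆Y (independent-tail⇒independent indI)

  -- For a dependency d of I - x in M[tail B], e = row₀(d′)·c − row₀(c)·d′ is one of I in M[B];
  -- its x-coordinate row₀(d′)·c x then forces row₀(d′) ≡ 0, so d′ is one in M[B] as well.
  independent⇒tail-independent-minus : ∀ {I c x} → Independent p B I →
    IsZeroComb p (tail B) I c → x ∈ I → ¬ p ∣ c x → Independent p (tail B) (I - x)
  independent⇒tail-independent-minus {I} {c} {x} indI zc x∈I ¬p∣cx d zd u u∈I-x =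
    subst (p ∣_) (restrict-∈ d u∈I-x)
          (indI d′ (zeroComb-tail⇒zeroComb {I} {d′} zd′ p∣row₀d′) u (I-x⊆I u∈I-x))
    where
    open ≡-Reasoning
    I-x⊆I : I - x ⊆ I
    I-x⊆I = p─q⊆p I ⁅ x ⁆
    d′ : Fin n → ℕ
    d′ = restrict (I - x) d
    zd′ : IsZeroComb p (tail B) I d′
    zd′ = isZeroComb-restrict (tail B) {f = d} I-x⊆I zd
    e : Fin n → ℕ
    e v = row₀ I d′ * c v + pred p * row₀ I c * d′ v
    p∣row₀e : p ∣ row₀ I e
    p∣row₀e = subst (p ∣_) (sym (lincomb-linear B I (row₀ I d′) (pred p * row₀ I c) c d′ zero))
                           (p∣x*y+pred[p]*y*x p (row₀ I d′) (row₀ I c))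
    ze : IsZeroComb p B I e
    ze = zeroComb-tail⇒zeroComb {I} {e}
           (isZeroComb-linear (tail B) {T = I} {c} {d′} zc zd′ (row₀ I d′) (pred p * row₀ I c)) p∣row₀e
    e[x]≡ : e x ≡ row₀ I d′ * c x
    e[x]≡ = begin
      row₀ I d′ * c x + pred p * row₀ I c * d′ x
        ≡⟨ cong (λ t → row₀ I d′ * c x + pred p * row₀ I c * t) (restrict-∉ d (x∉p-x I x)) ⟩
      row₀ I d′ * c x + pred p * row₀ I c * 0
        ≡⟨ cong (row₀ I d′ * c x +_) (*-zeroʳ (pred p * row₀ I c)) ⟩
      row₀ I d′ * c x + 0
        ≡⟨ +-identityʳ _ ⟩
      row₀ I d′ * c x                            ∎
    p∣row₀d′ : p ∣ row₀ I d′
    p∣row₀d′ = [ id , (λ p∣cx → contradiction p∣cx ¬p∣cx) ]′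
      (euclidsLemma _ _ p-prime (subst (p ∣_) e[x]≡ (indI e ze x x∈I)))

  rank≤1+rank-tail : ∀ {Y k k′} → IsRank p (tail B) Y k → IsRank p B Y k′ → k′ ≤ suc k
  rank≤1+rank-tail {Y} {k} (_ , maximal) ((I , I⊆Y , indI , refl) , _) =
    decidable-stable (∣ I ∣ ≤? suc k) do
      no dependent ← ¬¬-excluded-middle
        where yes independent → pure (≤-trans (maximal I I⊆Y independent) (n≤1+n k))
      (c , zc , x , x∈I , ¬p∣cx) ← ¬¬-nontrivialZeroComb p (tail B) dependent
      pure (≤-trans (∣p∣≤1+∣p-x∣ I x)
                    (s≤s (maximal (I - x) (λ x∈I-x → I⊆Y (p─q⊆p I ⁅ x ⁆ x∈I-x))
                                  (independent⇒tail-independent-minus {c = c} indI zc x∈I ¬p∣cx))))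

  module _ {X I : Subset n} (I⊆X : I ⊆ X) (indI : Independent p (tail B) I)
           (maximal : ∀ J → J ⊆ X → Independent p B J → ∣ J ∣ ≤ ∣ I ∣) where

    I∪⁅x⁆⊆X : ∀ {x} → x ∈ X → I ∪ ⁅ x ⁆ ⊆ X
    I∪⁅x⁆⊆X = ∈p∪⁅x⁆-elim (_∈ X) I⊆X

    I∪⁅x⁆-dependent : ∀ {x} → x ∈ X → x ∉ I → Dependent p B (I ∪ ⁅ x ⁆)
    I∪⁅x⁆-dependent {x} x∈X x∉I ind =
      <⇒≱ (p⊂q⇒∣p∣<∣q∣ (p⊆p∪q {p = I} ⁅ x ⁆ , x , q⊆p∪q I ⁅ x ⁆ (x∈⁅x⁆ x) , x∉I))
          (maximal (I ∪ ⁅ x ⁆) (I∪⁅x⁆⊆X x∈X) ind)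

    ¬p∣new-coefficient : ∀ {x e u} → IsZeroComb p B (I ∪ ⁅ x ⁆) e →
                         u ∈ I ∪ ⁅ x ⁆ → ¬ p ∣ e u → ¬ p ∣ e x
    ¬p∣new-coefficient {x} {e} ze u∈ ¬p∣eu p∣ex =
      ¬p∣eu (∈p∪⁅x⁆-elim (λ v → p ∣ e v) vanishes-on-I p∣ex u∈)
      where
      vanishes-on-I : ∀ {v} → v ∈ I → p ∣ e v
      vanishes-on-I {v} = indI e (isZeroComb-shrink (tail B) (p⊆p∪q ⁅ x ⁆) off-I (λ i → ze (suc i))) v
        where
        off-I : ∀ v → v ∈ I ∪ ⁅ x ⁆ → v ∉ I → p ∣ e v
        off-I v = ∈p∪⁅x⁆-elim (λ v → v ∉ I → p ∣ e v) (λ v∈I v∉I → contradiction v∈I v∉I)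
                              (λ _ → p∣ex)

    -- Gaussian elimination of the columns of X outside I: d remains a dependency of M[tail B] on
    -- which the new row does not vanish, and becomes supported on I, where it must vanish.
    Reduced : List (Fin n) → Set
    Reduced xs = ∃ λ d → IsZeroComb p (tail B) X d × ¬ p ∣ row₀ X d ×
                         All (λ y → y ∈ X → y ∉ I → p ∣ d y) xs

    eliminate : ∀ {x xs} → x ∈ X → Reduced xs → ∀ e → IsZeroComb p B (I ∪ ⁅ x ⁆) e → ¬ p ∣ e x →
                Reduced (x ∷ xs)
    eliminate {x} x∈X (d , zd , ¬p∣row₀d , reduced) e ze ¬p∣ex =
      d′ , zd′ , ¬p∣row₀d′ , (λ _ _ → p∣d′x) ∷ All.map keep reduced
      where
      e′ : Fin n → ℕ
      e′ = restrict (I ∪ ⁅ x ⁆) e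
      d′ : Fin n → ℕ
      d′ v = e x * d v + pred p * d x * e′ v
      ze′ : IsZeroComb p B X e′
      ze′ = isZeroComb-restrict B {f = e} (I∪⁅x⁆⊆X x∈X) ze
      zd′ : IsZeroComb p (tail B) X d′
      zd′ = isZeroComb-linear (tail B) {T = X} {d} {e′} zd (λ i → ze′ (suc i)) (e x) (pred p * d x)
      ¬p∣row₀d′ : ¬ p ∣ row₀ X d′
      ¬p∣row₀d′ p∣row₀d′ =
        [ ¬p∣ex , ¬p∣row₀d ]′
          (euclidsLemma _ _ p-prime (∣m+n∣m⇒∣n p∣sum (∣n⇒∣m*n (pred p * d x) (ze′ zero))))
        where
        p∣sum : p ∣ pred p * d x * row₀ X e′ + e x * row₀ X d
        p∣sum = subst (p ∣_) (trans (lincomb-linear B X (e x) (pred p * d x) d e′ zero)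
                                    (+-comm (e x * row₀ X d) _))
                      p∣row₀d′
      p∣d′x : p ∣ d′ x
      p∣d′x = subst (λ t → p ∣ e x * d x + pred p * d x * t)
                    (sym (restrict-∈ e (q⊆p∪q I ⁅ x ⁆ (x∈⁅x⁆ x))))
                    (p∣x*y+pred[p]*y*x p (e x) (d x))
      keep : ∀ {y} → (y ∈ X → y ∉ I → p ∣ d y) → y ∈ X → y ∉ I → p ∣ d′ y
      keep {y} p∣dy y∈X y∉I with y ≟ x
      ... | yes refl = p∣d′x
      ... | no y≢x   = ∣m∣n⇒∣m+n (∣n⇒∣m*n (e x) (p∣dy y∈X y∉I))
                         (∣n⇒∣m*n (pred p * d x) (subst (p ∣_) (sym (restrict-∉ e y∉I∪⁅x⁆)) (p ∣0)))
        where
        y∉I∪⁅x⁆ : y ∉ I ∪ ⁅ x ⁆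
        y∉I∪⁅x⁆ y∈ = ∈p∪⁅x⁆-elim (λ v → v ≢ x → ¬ v ∉ I)
                                  (λ v∈I _ v∉I → v∉I v∈I) (λ x≢x _ → x≢x refl) y∈ y≢x y∉I

    reduce-step : ∀ {x xs} → Reduced xs → ¬ ¬ Reduced (x ∷ xs)
    reduce-step {x} r@(d , zd , ¬p∣row₀d , reduced) with x ∈? X | x ∈? I | p ∣? d x
    ... | yes x∈X | no x∉I | no _ = do
      (e , ze , u , u∈ , ¬p∣eu) ← ¬¬-nontrivialZeroComb p B (I∪⁅x⁆-dependent x∈X x∉I)
      pure (eliminate x∈X r e ze (¬p∣new-coefficient ze u∈ ¬p∣eu))
    ... | no x∉X | _       | _        = pure (d , zd , ¬p∣row₀d ,
                                               (λ x∈X _ → contradiction x∈X x∉X) ∷ reduced)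
    ... | _      | yes x∈I | _        = pure (d , zd , ¬p∣row₀d ,
                                               (λ _ x∉I → contradiction x∈I x∉I) ∷ reduced)
    ... | _      | _       | yes p∣dx = pure (d , zd , ¬p∣row₀d , (λ _ _ → p∣dx) ∷ reduced)

    irreducible : ¬ Reduced (allFin n)
    irreducible (d , zd , ¬p∣row₀d , reduced) = ¬p∣row₀d (∣-lincomb B X d zero vanishes)
      where
      off-I : ∀ v → v ∈ X → v ∉ I → p ∣ d v
      off-I v = All.lookup reduced (∈-allFin v)
      vanishes : ∀ v → v ∈ X → p ∣ d v
      vanishes v v∈X with v ∈? I
      ... | yes v∈I = indI d (isZeroComb-shrink (tail B) I⊆X off-I zd) v v∈I
      ... | no v∉I  = off-I v v∈X v∉I

    ¬¬-reduced : Reduced [] → ∀ xs → ¬ ¬ Reduced xs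
    ¬¬-reduced r []       = pure r
    ¬¬-reduced r (x ∷ xs) = ¬¬-reduced r xs >>= reduce-step

    rank-preserved⇒row₀-vanishes : ∀ d → IsZeroComb p (tail B) X d → p ∣ row₀ X d
    rank-preserved⇒row₀-vanishes d zd = decidable-stable (p ∣? row₀ X d) λ ¬p∣row₀d →
      ¬¬-reduced (d , zd , ¬p∣row₀d , []) (allFin n) irreducible

  rank-tail<rank : ∀ {X C c k k′} → C ⊆ X → IsZeroComb p (tail B) C c → ¬ p ∣ row₀ C c →
                   IsRank p (tail B) X k → IsRank p B X k′ → k < k′
  rank-tail<rank {X} {C} {c} {k′ = k′} C⊆X zc ¬p∣row₀c ((I , I⊆X , indI , refl) , _) (_ , maximal) =
    decidable-stable (∣ I ∣ <? k′) λ ∣I∣≮k′ → ¬p∣row₀c (subst (p ∣_) (lincomb-restrict B C⊆X c zero)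
      (rank-preserved⇒row₀-vanishes I⊆X indI
        (λ J J⊆X indJ → ≤-trans (maximal J J⊆X indJ) (≮⇒≥ ∣I∣≮k′))
        (restrict C c) (isZeroComb-restrict (tail B) {f = c} C⊆X zc)))

lincomb-splitRow : ∀ {m n} (A : Matrix m n) {a b} → a ≢ b → ∀ α T c →
  lincomb (splitMatrix A a b α) T c zero ≡ (restrict T c a + restrict T c b) * α
lincomb-splitRow A {a} {b} a≢b α T c = begin
  lincomb (splitMatrix A a b α) T c zero   ≡⟨ sum-cong-≗ pointwise ⟩
  sum (λ u → at a u + at b u)              ≡⟨ ∑-distrib-+ (at a) (at b) ⟩
  sum (at a) + sum (at b)                  ≡⟨ cong₂ _+_ (sum-indicator a _) (sum-indicator b _) ⟩
  restrict T c a * α + restrict T c b * α  ≡⟨ sym (*-distribʳ-+ α (restrict T c a) (restrict T c b)) ⟩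
  (restrict T c a + restrict T c b) * α    ∎
  where
  open ≡-Reasoning
  at : Fin _ → Fin _ → ℕ
  at x u = if does (u ≟ x) then restrict T c x * α else 0
  pointwise : ∀ u → (if lookup T u then c u * splitMatrix A a b α zero u else 0) ≡ at a u + at b u
  pointwise u with u ≟ a | u ≟ b
  ... | yes refl | yes refl = contradiction refl a≢b
  ... | yes refl | no _ with lookup T u
  ...   | true  = sym (+-identityʳ _)
  ...   | false = refl
  pointwise u | no _ | yes refl with lookup T u
  ...   | true  = refl
  ...   | false = refl
  pointwise u | no _ | no _ with lookup T u
  ...   | true  = *-zeroʳ (c u)
  ...   | false = refl

module SplitMatrix {m n p : ℕ} (p-prime : Prime p) (A : Matrix m n) {a b : Fin n} (a≢b : a ≢ b)
                   {α : ℕ} (p∤α : ¬ p ∣ α) where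

  open OneMoreRow p-prime (splitMatrix A a b α)

  row₀≢0 : ∀ T c → ¬ p ∣ restrict T c a + restrict T c b → ¬ p ∣ row₀ T c
  row₀≢0 T c ¬p∣ p∣row₀ =
    [ ¬p∣ , p∤α ]′ (euclidsLemma _ _ p-prime (subst (p ∣_) (lincomb-splitRow A a≢b α T c) p∣row₀))

  npCircuit⇒¬¬brokenDependency : ∀ {C} → IsNpCircuit p A a b C →
    ¬ ¬ ∃ λ c → IsZeroComb p A C c × ¬ p ∣ row₀ C c
  npCircuit⇒¬¬brokenDependency {C} (circuit , inj₁ (a∈C , b∉C)) = do
    (c , zc , ¬p∣ca) ← circuit⇒¬¬nonzeroCoefficient p A circuit a∈C
    pure (c , zc , row₀≢0 C c (subst (λ t → ¬ p ∣ t)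
      (sym (trans (cong₂ _+_ (restrict-∈ c a∈C) (restrict-∉ c b∉C)) (+-identityʳ (c a)))) ¬p∣ca))
  npCircuit⇒¬¬brokenDependency {C} (circuit , inj₂ (inj₁ (a∉C , b∈C))) = do
    (c , zc , ¬p∣cb) ← circuit⇒¬¬nonzeroCoefficient p A circuit b∈C
    pure (c , zc , row₀≢0 C c (subst (λ t → ¬ p ∣ t)
      (sym (cong₂ _+_ (restrict-∉ c a∉C) (restrict-∈ c b∈C))) ¬p∣cb))
  npCircuit⇒¬¬brokenDependency {C} (_ , inj₂ (inj₂ (a∈C , b∈C , c , (zc , _) , ¬p∣ca+cb))) =
    pure (c , zc , row₀≢0 C c (subst (λ t → ¬ p ∣ t)
      (sym (cong₂ _+_ (restrict-∈ c a∈C) (restrict-∈ c b∈C))) ¬p∣ca+cb))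

  containsNpCircuit⇒rank<rank : ∀ {X k k′} → ContainsNpCircuit p A a b X →
    IsRank p A X k → IsRank p (splitMatrix A a b α) X k′ → k < k′
  containsNpCircuit⇒rank<rank {k = k} {k′} (C , C⊆X , npCircuit) rank rank′ =
    decidable-stable (k <? k′) do
      (c , zc , ¬p∣row₀c) ← npCircuit⇒¬¬brokenDependency npCircuit
      pure (rank-tail<rank {c = c} C⊆X zc ¬p∣row₀c rank rank′)

  rank-sum<rank-sum : ∀ {S kS kT k′S k′T} →
    ContainsNpCircuit p A a b S ⊎ ContainsNpCircuit p A a b (∁ S) →
    IsRank p A S kS → IsRank p A (∁ S) kT →
    IsRank p (splitMatrix A a b α) S k′S → IsRank p (splitMatrix A a b α) (∁ S) k′T →
    kS + kT < k′S + k′T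
  rank-sum<rank-sum (inj₁ npS) rS rT r′S r′T =
    +-mono-<-≤ (containsNpCircuit⇒rank<rank npS rS r′S) (rank-tail≤rank rT r′T)
  rank-sum<rank-sum (inj₂ npT) rS rT r′S r′T =
    +-mono-≤-< (rank-tail≤rank rS r′S) (containsNpCircuit⇒rank<rank npT rT r′T)

mainTheorem7 : (p : ℕ) → Prime p → (m n : ℕ) → (A : Matrix m n) →
    Connected p A → (a b : Fin n) → ¬ (a ≡ b) → (α : ℕ) → ¬ (p ∣ α) →
    (∀ (S : Subset n) → S ⊂ ⊤ → Nonempty S →
      ContainsNpCircuit p A a b S ⊎ ContainsNpCircuit p A a b (∁ S)) →
    Connected p (splitMatrix A a b α)
mainTheorem7 p p-prime m n A connected a b a≢b α p∤α np-split S
  (nonemptyS , nonempty∁S@(x , x∈∁S) , k′S , k′T , k′E , r′S , r′T , r′E , k′S+k′T≤k′E) =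
  ¬¬-separation (connected S)
  where
  open SplitMatrix p-prime A a≢b p∤α
  open OneMoreRow p-prime (splitMatrix A a b α)
  open ≤-Reasoning
  np-circuit : ContainsNpCircuit p A a b S ⊎ ContainsNpCircuit p A a b (∁ S)
  np-circuit = np-split S ((λ _ → ∈⊤) , x , ∈⊤ , x∈∁p⇒x∉p x∈∁S) nonemptyS
  ¬¬-separation : ¬ ¬ OneSeparation p A S
  ¬¬-separation = do
    (kS , rS) ← ¬¬-rank p A S
    (kT , rT) ← ¬¬-rank p A (∁ S)
    (kE , rE) ← ¬¬-rank p A ⊤
    pure (nonemptyS , nonempty∁S , kS , kT , kE , rS , rT , rE , s≤s⁻¹ (begin-strict
      kS + kT    <⟨ rank-sum<rank-sum np-circuit rS rT r′S r′T ⟩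
      k′S + k′T  ≤⟨ k′S+k′T≤k′E ⟩
      k′E        ≤⟨ rank≤1+rank-tail rE r′E ⟩
      suc kE     ∎))
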